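{- Let $n,m$ be positive integers, let $G$ be a finite simple graph with $n^2$ vertices and $H$ a finite simple graph with $m^2$ vertices. If $O\chi(G)=n$, then $O\chi(G\times H)=nm$.
   Context: Two vertex colourings $c_1,c_2$ of a graph are orthogonal if no two distinct vertices receive the same ordered pair $(c_1(v),c_2(v))$. An orthogonal colouring of a graph is a pair of orthogonal proper vertex colourings. The orthogonal chromatic number $O\chi(G)$ is the minimum $N$ such that $G$ has an orthogonal colouring in which both colourings use colours from a set of $N$ colours. The tensor product $G\times H$ has vertex set $V(G)\times V(H)$, with $(u_1,v_1)$ adjacent to $(u_2,v_2)$ if and only if $u_1u_2\in E(G)$ and $v_1v_2\in E(H)$. -}

module Defs where

open import Level using (Level; _⊔_; suc)
open import Data.Nat using (ℕ; _≤_)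
open import Data.Fin using (Fin)
open import Data.Product using (Σ; _×_; _,_; proj₁; proj₂)
open import Relation.Binary.PropositionalEquality using (_≡_; _≢_)
open import Relation.Nullary using (¬_)

record SimpleGraph {a} (V : Set a) : Set (suc a) where
  field
    Adj   : V → V → Set a
    irrefl : ∀ {v} → ¬ Adj v v
    sym    : ∀ {u v} → Adj u v → Adj v u
open SimpleGraph public

-- Tensor (categorical) product: (u1,v1) ~ (u2,v2) iff u1 ~ u2 in G and v1 ~ v2 in H.
_⊗_ : ∀ {a} {V W : Set a} → SimpleGraph V → SimpleGraph W → SimpleGraph (V × W)
G ⊗ H = record
  { Adj    = λ p q → Adj G (proj₁ p) (proj₁ q) × Adj H (proj₂ p) (proj₂ q)
  ; irrefl = λ x → irrefl G (proj₁ x)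
  ; sym    = λ x → sym G (proj₁ x) , sym H (proj₂ x)
  }

Proper : ∀ {a} {V : Set a} → SimpleGraph V → {N : ℕ} → (V → Fin N) → Set a
Proper G c = ∀ {u v} → Adj G u v → c u ≢ c v

Orthogonal : ∀ {a} {V : Set a} {N : ℕ} → (V → Fin N) → (V → Fin N) → Set a
Orthogonal c₁ c₂ = ∀ u v → c₁ u ≡ c₁ v → c₂ u ≡ c₂ v → u ≡ v

record OrthColouring {a} {V : Set a} (G : SimpleGraph V) (N : ℕ) : Set a where
  field
    c₁ c₂   : V → Fin N
    proper₁ : Proper G c₁
    proper₂ : Proper G c₂
    orth    : Orthogonal c₁ c₂

OχIs : ∀ {a} {V : Set a} → SimpleGraph V → ℕ → Set a
OχIs G N = OrthColouring G N × (∀ M → OrthColouring G M → N ≤ M)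

-- A pair of orthogonal colourings with N colours injects the vertices into Fin N × Fin N,
-- so a graph on k vertices needs N² ≥ k; for G × H that is N ≥ nm, whatever G and H are.
-- Conversely, pair an optimal orthogonal colouring (c₁, c₂) of G with a bijection
-- (d₁, d₂) : V(H) ≅ Fin m × Fin m: the colourings (c₁ u, d₁ v) and (c₂ u, d₂ v) are proper
-- because adjacency in G × H projects to adjacency in G, and orthogonal because both
-- (c₁, c₂) and (d₁, d₂) are injective.
module Submission where

open import Defs
open import Data.Nat using (ℕ; _*_; NonZero; _≤_)
open import Data.Nat.Properties using (≮⇒≥; <⇒≱; *-mono-<; [m*n]*[o*p]≡[m*o]*[n*p])
open import Data.Fin using (Fin; combine; remQuot)
open import Data.Fin.Properties using (combine-injective; combine-remQuot; injective⇒≤; *↔×)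
open import Data.Product using (_,_; proj₁; proj₂; uncurry)
open import Function using (_∘_; _↣_; Injection)
open import Function.Definitions using (Injective)
open import Function.Properties.Inverse using (↔⇒↣)
open import Relation.Binary.PropositionalEquality using (_≡_; cong; cong₂; subst; module ≡-Reasoning)

m*m≤n*n⇒m≤n : ∀ m n → m * m ≤ n * n → m ≤ n
m*m≤n*n⇒m≤n m n le = ≮⇒≥ (λ n<m → <⇒≱ (*-mono-< n<m n<m) le)

pairing : ∀ {a} {V : Set a} {N K : ℕ} → (V → Fin N) → (V → Fin K) → V → Fin (N * K)
pairing c d v = combine (c v) (d v)

module _ {a} {V : Set a} {N : ℕ} {c d : V → Fin N} where

  pairing-injective⇒orthogonal : Injective _≡_ _≡_ (pairing c d) → Orthogonal c d
  pairing-injective⇒orthogonal inj u v cu≡cv du≡dv = inj (cong₂ combine cu≡cv du≡dv)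

  orthogonal⇒pairing-injective : Orthogonal c d → Injective _≡_ _≡_ (pairing c d)
  orthogonal⇒pairing-injective orth {u} {v} eq =
    let cu≡cv , du≡dv = combine-injective (c u) (d u) (c v) (d v) eq in orth u v cu≡cv du≡dv

remQuot-orthogonal : ∀ m → Orthogonal (proj₁ ∘ remQuot {m} m) (proj₂ ∘ remQuot {m} m)
remQuot-orthogonal m = pairing-injective⇒orthogonal remQuot-injective
  where
  open ≡-Reasoning
  remQuot-injective : Injective _≡_ _≡_ (pairing (proj₁ ∘ remQuot {m} m) (proj₂ ∘ remQuot {m} m))
  remQuot-injective {u} {v} eq = begin
    u                                 ≡⟨ combine-remQuot {m} m u ⟨
    uncurry combine (remQuot {m} m u) ≡⟨ eq ⟩
    uncurry combine (remQuot {m} m v) ≡⟨ combine-remQuot {m} m v ⟩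
    v                                 ∎

orthColouring-size : ∀ {a} {V : Set a} {G : SimpleGraph V} {k N : ℕ} →
                     Fin k ↣ V → OrthColouring G N → k ≤ N * N
orthColouring-size e χ =
  injective⇒≤ {f = pairing c₁ c₂ ∘ to} (injective ∘ orthogonal⇒pairing-injective orth)
  where
  open OrthColouring χ
  open Injection e

module _ {a} {V W : Set a} {G : SimpleGraph V} {H : SimpleGraph W} {N K : ℕ} where

  ⊗-proper : {c : V → Fin N} (d : W → Fin K) → Proper G c →
             Proper (G ⊗ H) (pairing (c ∘ proj₁) (d ∘ proj₂))
  ⊗-proper {c} d proper {u , v} {u′ , v′} (u~u′ , _) eq =
    proper u~u′ (proj₁ (combine-injective (c u) (d v) (c u′) (d v′) eq))

  ⊗-orthColouring : OrthColouring G N → (d₁ d₂ : W → Fin K) → Orthogonal d₁ d₂ →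
                    OrthColouring (G ⊗ H) (N * K)
  ⊗-orthColouring χ d₁ d₂ orthᵈ = record
    { c₁      = pairing (c₁ ∘ proj₁) (d₁ ∘ proj₂)
    ; c₂      = pairing (c₂ ∘ proj₁) (d₂ ∘ proj₂)
    ; proper₁ = ⊗-proper d₁ proper₁
    ; proper₂ = ⊗-proper d₂ proper₂
    ; orth    = λ { (u , v) (u′ , v′) eq₁ eq₂ →
        let c₁u≡c₁u′ , d₁v≡d₁v′ = combine-injective (c₁ u) (d₁ v) (c₁ u′) (d₁ v′) eq₁
            c₂u≡c₂u′ , d₂v≡d₂v′ = combine-injective (c₂ u) (d₂ v) (c₂ u′) (d₂ v′) eq₂
        in cong₂ _,_ (orth u u′ c₁u≡c₁u′ c₂u≡c₂u′) (orthᵈ v v′ d₁v≡d₁v′ d₂v≡d₂v′) }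
    }
    where open OrthColouring χ

mainTheorem2 : (n m : ℕ) → .{{NonZero n}} → .{{NonZero m}} →
    (G : SimpleGraph (Fin (n * n))) → (H : SimpleGraph (Fin (m * m))) →
    OχIs G n → OχIs (G ⊗ H) (n * m)
mainTheorem2 n m G H (χ , _) = upper , lower
  where
  upper : OrthColouring (G ⊗ H) (n * m)
  upper = ⊗-orthColouring {H = H} χ (proj₁ ∘ remQuot {m} m) (proj₂ ∘ remQuot {m} m)
                                    (remQuot-orthogonal m)

  lower : ∀ M → OrthColouring (G ⊗ H) M → n * m ≤ M
  lower M χ′ = m*m≤n*n⇒m≤n (n * m) M
    (subst (_≤ M * M) ([m*n]*[o*p]≡[m*o]*[n*p] n n m m) (orthColouring-size (↔⇒↣ *↔×) χ′))
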